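{- Let $G$ be a connected graph with $n\ge 3$ vertices that is not complete. Then at most $\frac{n^2-5n+8}{2}$ unordered pairs of distinct vertices $\{u,v\}$ satisfy $\Omega_G(u,v)=\frac{2}{n}$.
   Context: All graphs are finite and simple. For a connected graph $G$, regard each edge as a unit resistor. $\Omega_G(u,v)$ is the effective resistance (resistance distance) between $u$ and $v$. -}

module Defs where

open import Data.Nat using (ℕ; zero; suc; _<_)
open import Data.Fin using (Fin; toℕ)
open import Data.Bool using (Bool; true; false)
open import Data.Integer using (+_)
open import Data.Rational using (ℚ; 0ℚ; 1ℚ; _+_; _-_; _*_; _/_)
open import Data.Product using (Σ; _×_; ∃-syntax)
open import Data.List using (List; length)
open import Relation.Binary.PropositionalEquality using (_≡_; _≢_)
open import Relation.Nullary using (yes; no)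
open import Data.Fin.Properties using (_≟_)

record Graph (n : ℕ) : Set where
  field
    adj   : Fin n → Fin n → Bool
    sym   : ∀ u v → adj u v ≡ adj v u
    irrefl : ∀ u → adj u u ≡ false
open Graph public

data Walk {n : ℕ} (G : Graph n) : Fin n → Fin n → Set where
  here : ∀ {u} → Walk G u u
  step : ∀ {u w v} → adj G u w ≡ true → Walk G w v → Walk G u v

Connected : ∀ {n} → Graph n → Set
Connected G = ∀ u v → Walk G u v

Complete : ∀ {n} → Graph n → Set
Complete {n} G = ∀ (u v : Fin n) → u ≢ v → adj G u v ≡ true

sumFin : (n : ℕ) → (Fin n → ℚ) → ℚ
sumFin zero f = 0ℚ
sumFin (suc n) f = f Fin.zero + sumFin n (λ i → f (Fin.suc i))

b2q : Bool → ℚ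
b2q true = 1ℚ
b2q false = 0ℚ

laplacian : ∀ {n} → Graph n → (Fin n → ℚ) → (Fin n → ℚ)
laplacian {n} G x i = sumFin n (λ j → b2q (adj G i j) * (x i - x j))

unitDiff : ∀ {n} → Fin n → Fin n → Fin n → ℚ
unitDiff u v i with i ≟ u | i ≟ v
... | yes _ | yes _ = 0ℚ
... | yes _ | no _  = 1ℚ
... | no _  | yes _ = 0ℚ - 1ℚ
... | no _  | no _  = 0ℚ

-- Effective resistance (Kirchhoff): Ω_G(u,v) = r iff there is a potential x
-- with L x = e_u - e_v (unit current injected at u, extracted at v) and
-- x u - x v = r.  For connected G such x exists and x u - x v is unique.
ResistanceIs : ∀ {n} → Graph n → Fin n → Fin n → ℚ → Set
ResistanceIs {n} G u v r =
  ∃[ x ] ((∀ i → laplacian G x i ≡ unitDiff u v i) × (x u - x v ≡ r))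

-- the rational 2/n (n ≥ 3 in use, value at 0 irrelevant)
twoOver : ℕ → ℚ
twoOver zero = 0ℚ
twoOver (suc m) = + 2 / suc m

module Submission where

-- Let x be the potential of a unit current from u to v.  By the maximum principle x is largest at u
-- and smallest at v, so every term of  Σ_{j ≁ u} (x u − x j) + Σ_{j ≁ v} (x j − x v)  is non-negative,
-- while the Laplacian equations evaluate the sum to n·Ω(u,v) − 2.  Hence Ω(u,v) = 2/n makes every term
-- vanish, which forces u (and symmetrically v) to be adjacent to all other vertices.  A non-complete
-- graph has two non-adjacent vertices a and b, so all pairs at resistance 2/n lie among the remaining
-- n − 2 vertices, and there are at most (n − 2)(n − 3)/2 ≤ (n² − 5n + 8)/2 of them.

open import Defs hiding (sym)
open import Data.Nat using (ℕ)
open import Data.Fin using (Fin)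

module ResistanceDistance where

  open import Data.Nat using (zero; suc)
  open import Data.Fin using (zero; suc)
  open import Data.Fin.Properties using (_≟_)
  open import Data.Bool using (true; false; not)
  open import Data.Integer as ℤ using (ℤ)
  import Data.Integer.Tactic.RingSolver as ℤ-Solver
  open import Data.Rational using (ℚ; 0ℚ; 1ℚ; _+_; _-_; _*_; -_; _/_; _≤_; _<_; toℚᵘ)
  open import Data.Rational.Properties
    using (≤-refl; ≤-trans; <-irrefl; <-≤-trans; <⇒≤; +-mono-≤; +-monoˡ-≤; +-monoʳ-≤; neg-antimono-≤;
           +-identityˡ; +-identityʳ; +-inverseʳ; *-identityˡ; *-zeroˡ; negative⁻¹; positive⁻¹; normalize-pos;
           toℚᵘ-injective; toℚᵘ-homo-+; toℚᵘ-fromℚᵘ; ≤-decTotalOrder; module ≤-Reasoning)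
  open import Data.Rational.Unnormalised as ℚᵘ using (mkℚᵘ; *≡*) renaming (_≃_ to _≃ᵘ_)
  import Data.Rational.Unnormalised.Properties as ℚᵘ
  open import Data.Rational.Solver using (module +-*-Solver)
  open +-*-Solver using (solve; _:+_; _:-_; _:*_; :-_; con; _:=_)
  open import Data.Product using (_,_)
  open import Data.List using (allFin)
  import Data.List.Relation.Unary.All as All
  open import Data.List.Membership.Propositional.Properties using (∈-allFin)
  open import Relation.Binary.Bundles using (DecTotalOrder)
  open import Data.List.Extrema (DecTotalOrder.totalOrder ≤-decTotalOrder) using (argmax; f[xs]≤f[argmax])
  open import Relation.Binary.PropositionalEquality
  open import Relation.Nullary using (yes; no)
  open import Data.Empty using (⊥-elim)
  open import Function using (_∘_)

  private variable
    n : ℕ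
    p q : ℚ
    f g : Fin n → ℚ

  sumFin-cong : (∀ j → f j ≡ g j) → sumFin n f ≡ sumFin n g
  sumFin-cong {n = zero}  _     = refl
  sumFin-cong {n = suc n} f≗g = cong₂ _+_ (f≗g zero) (sumFin-cong (f≗g ∘ suc))

  sumFin-+ : sumFin n (λ j → f j + g j) ≡ sumFin n f + sumFin n g
  sumFin-+ {n = zero}          = refl
  sumFin-+ {n = suc n} {f} {g} = trans (cong ((f zero + g zero) +_) (sumFin-+ {f = f ∘ suc} {g ∘ suc}))
    (solve 4 (λ a b c d → (a :+ b) :+ (c :+ d) := (a :+ c) :+ (b :+ d)) refl
      (f zero) (g zero) (sumFin n (f ∘ suc)) (sumFin n (g ∘ suc)))

  sumFin-neg : sumFin n (λ j → - f j) ≡ - sumFin n f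
  sumFin-neg {n = zero}      = refl
  sumFin-neg {n = suc n} {f} = trans (cong (- f zero +_) (sumFin-neg {f = f ∘ suc}))
    (solve 2 (λ a b → (:- a) :+ (:- b) := :- (a :+ b)) refl (f zero) (sumFin n (f ∘ suc)))

  sumFin-− : sumFin n (λ j → f j - g j) ≡ sumFin n f - sumFin n g
  sumFin-− {f = f} {g} = trans (sumFin-+ {f = f}) (cong (sumFin _ f +_) (sumFin-neg {f = g}))

  p≤q⇒0≤q-p : p ≤ q → 0ℚ ≤ q - p
  p≤q⇒0≤q-p {p} {q} p≤q = subst (_≤ q - p) (+-inverseʳ p) (+-monoˡ-≤ (- p) p≤q)

  p≤q⇒p-q≤0 : p ≤ q → p - q ≤ 0ℚ
  p≤q⇒p-q≤0 {p} {q} p≤q = subst (p - q ≤_) (+-inverseʳ q) (+-monoˡ-≤ (- q) p≤q)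

  p-q≤0⇒p≤q : p - q ≤ 0ℚ → p ≤ q
  p-q≤0⇒p≤q {p} {q} p-q≤0 = subst₂ _≤_
    (solve 2 (λ p q → (p :- q) :+ q := p) refl p q) (+-identityˡ q) (+-monoˡ-≤ q p-q≤0)

  neg-cancel-≤ : - p ≤ - q → q ≤ p
  neg-cancel-≤ {p} {q} -p≤-q = subst₂ _≤_ (neg-involutive q) (neg-involutive p) (neg-antimono-≤ -p≤-q)
    where
    neg-involutive : ∀ p → - (- p) ≡ p
    neg-involutive = solve 1 (λ p → :- (:- p) := p) refl

  p≤p+q : 0ℚ ≤ q → p ≤ p + q
  p≤p+q {q} {p} 0≤q = subst (_≤ p + q) (+-identityʳ p) (+-monoʳ-≤ p 0≤q)

  p≤q+p : 0ℚ ≤ q → p ≤ q + p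
  p≤q+p {q} {p} 0≤q = subst (_≤ q + p) (+-identityˡ p) (+-monoˡ-≤ p 0≤q)

  sumFin-nonneg : (∀ j → 0ℚ ≤ f j) → 0ℚ ≤ sumFin n f
  sumFin-nonneg {n = zero}  _   = ≤-refl
  sumFin-nonneg {n = suc n} f≥0 = +-mono-≤ (f≥0 zero) (sumFin-nonneg (f≥0 ∘ suc))

  term≤sumFin : (∀ j → 0ℚ ≤ f j) → ∀ k → f k ≤ sumFin n f
  term≤sumFin {n = suc n} f≥0 zero    = p≤p+q (sumFin-nonneg (f≥0 ∘ suc))
  term≤sumFin {n = suc n} f≥0 (suc k) = ≤-trans (term≤sumFin (f≥0 ∘ suc) k) (p≤q+p (f≥0 zero))

  sumFin-const-/ : ∀ n (i : ℤ) k → toℚᵘ (sumFin n (λ _ → i / suc k)) ≃ᵘ mkℚᵘ (ℤ.+ n ℤ.* i) k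
  sumFin-const-/ zero    i k = *≡* refl
  sumFin-const-/ (suc n) i k = ℚᵘ.≃-trans (toℚᵘ-homo-+ (i / suc k) (sumFin n (λ _ → i / suc k)))
    (ℚᵘ.≃-trans (ℚᵘ.+-cong (toℚᵘ-fromℚᵘ (mkℚᵘ i k)) (sumFin-const-/ n i k))
      (*≡* (add-fractions i (ℤ.+ n) ℤ.+[1+ k ])))
    where
    add-fractions : ∀ i n d →
                    (i ℤ.* d ℤ.+ (n ℤ.* i) ℤ.* d) ℤ.* d ≡ ((ℤ.+ 1 ℤ.+ n) ℤ.* i) ℤ.* (d ℤ.* d)
    add-fractions = ℤ-Solver.solve-∀

  sumFin-twoOver : ∀ k → sumFin (suc k) (λ _ → twoOver (suc k)) ≡ 1ℚ + 1ℚ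
  sumFin-twoOver k =
    toℚᵘ-injective (ℚᵘ.≃-trans (sumFin-const-/ (suc k) (ℤ.+ 2) k) (*≡* (cancel ℤ.+[1+ k ])))
    where
    cancel : ∀ d → (d ℤ.* ℤ.+ 2) ℤ.* ℤ.+ 1 ≡ ℤ.+ 2 ℤ.* d
    cancel = ℤ-Solver.solve-∀

  twoOver-pos : ∀ k → 0ℚ < twoOver (suc k)
  twoOver-pos k = positive⁻¹ (twoOver (suc k)) {{normalize-pos 2 (suc k)}}

  private variable
    u v w w′ : Fin n
    r M : ℚ

  unitDiff-source : u ≢ v → unitDiff u v u ≡ 1ℚ
  unitDiff-source {u = u} {v} u≢v with u ≟ u | u ≟ v
  ... | yes _   | yes u≡v = ⊥-elim (u≢v u≡v)
  ... | yes _   | no _    = refl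
  ... | no u≢u  | _       = ⊥-elim (u≢u refl)

  unitDiff-≤0 : ∀ {j} → j ≢ u → unitDiff u v j ≤ 0ℚ
  unitDiff-≤0 {u = u} {v} {j} j≢u with j ≟ u | j ≟ v
  ... | yes j≡u | _     = ⊥-elim (j≢u j≡u)
  ... | no _    | yes _ = <⇒≤ (negative⁻¹ (0ℚ - 1ℚ))
  ... | no _    | no _  = ≤-refl

  unitDiff-swap : ∀ (u v j : Fin n) → unitDiff v u j ≡ - unitDiff u v j
  unitDiff-swap u v j with j ≟ u | j ≟ v
  ... | yes _ | yes _ = refl
  ... | yes _ | no _  = refl
  ... | no _  | yes _ = refl
  ... | no _  | no _  = refl

  b2q-*-nonneg : ∀ a {p} → 0ℚ ≤ p → 0ℚ ≤ b2q a * p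
  b2q-*-nonneg true  {p} 0≤p = subst (0ℚ ≤_) (sym (*-identityˡ p)) 0≤p
  b2q-*-nonneg false {p} _   = subst (0ℚ ≤_) (sym (*-zeroˡ p)) ≤-refl

  b2q-not-* : ∀ a p → b2q (not a) * p ≡ p - b2q a * p
  b2q-not-* true  = solve 1 (λ p → con 0ℚ :* p := p :- con 1ℚ :* p) refl
  b2q-not-* false = solve 1 (λ p → con 1ℚ :* p := p :- con 0ℚ :* p) refl

  nonEdgeTerm : Graph n → (Fin n → ℚ) → Fin n → Fin n → ℚ
  nonEdgeTerm G x w j = b2q (not (adj G w j)) * (x w - x j)

  Potential : Graph n → Fin n → Fin n → (Fin n → ℚ) → Set
  Potential G u v x = ∀ i → laplacian G x i ≡ unitDiff u v i

  module _ (G : Graph n) (x : Fin n → ℚ) where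

    laplacian-neg : ∀ j → laplacian G (-_ ∘ x) j ≡ - laplacian G x j
    laplacian-neg j = trans (sumFin-cong λ k → neg-edge (b2q (adj G j k)) (x j) (x k))
      (sumFin-neg {f = λ k → b2q (adj G j k) * (x j - x k)})
      where
      neg-edge : ∀ a p q → a * (- p - - q) ≡ - (a * (p - q))
      neg-edge = solve 3 (λ a p q → a :* ((:- p) :- (:- q)) := :- (a :* (p :- q))) refl

    potential-neg : Potential G u v x → Potential G v u (-_ ∘ x)
    potential-neg {u} {v} pot i = begin
      laplacian G (-_ ∘ x) i ≡⟨ laplacian-neg i ⟩
      - laplacian G x i      ≡⟨ cong -_ (pot i) ⟩
      - unitDiff u v i       ≡⟨ unitDiff-swap u v i ⟨
      unitDiff v u i         ∎
      where open ≡-Reasoning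

    potential-source : u ≢ v → Potential G u v x → laplacian G x u ≡ 1ℚ
    potential-source {u} u≢v pot = trans (pot u) (unitDiff-source u≢v)

    potential-subharmonic : Potential G u v x → ∀ j → j ≢ u → laplacian G x j ≤ 0ℚ
    potential-subharmonic pot j j≢u = subst (_≤ 0ℚ) (sym (pot j)) (unitDiff-≤0 j≢u)

    neighbour-of-maximum : (∀ j → x j ≤ M) → M ≤ x w → laplacian G x w ≤ 0ℚ →
                           adj G w w′ ≡ true → M ≤ x w′
    neighbour-of-maximum {M} {w} {w′} x≤M M≤xw Lxw≤0 w∼w′ = ≤-trans M≤xw (p-q≤0⇒p≤q (begin
      x w - x w′                       ≡⟨ *-identityˡ (x w - x w′) ⟨
      b2q true * (x w - x w′)          ≡⟨ cong (λ a → b2q a * (x w - x w′)) w∼w′ ⟨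
      b2q (adj G w w′) * (x w - x w′)  ≤⟨ term≤sumFin edge-nonneg w′ ⟩
      laplacian G x w                  ≤⟨ Lxw≤0 ⟩
      0ℚ                               ∎))
      where
      open ≤-Reasoning
      edge-nonneg : ∀ j → 0ℚ ≤ b2q (adj G w j) * (x w - x j)
      edge-nonneg j = b2q-*-nonneg (adj G w j) (p≤q⇒0≤q-p (≤-trans (x≤M j) M≤xw))

    maximum-propagates : (∀ j → j ≢ u → laplacian G x j ≤ 0ℚ) → (∀ j → x j ≤ M) →
                         Walk G w u → M ≤ x w → M ≤ x u
    maximum-propagates sub x≤M here M≤xw = M≤xw
    maximum-propagates {u} sub x≤M (step {u = w} w∼w′ walk) M≤xw with w ≟ u
    ... | yes refl = M≤xw
    ... | no w≢u   = maximum-propagates sub x≤M walk (neighbour-of-maximum x≤M M≤xw (sub w w≢u) w∼w′)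

    maximum-principle : Connected G → (∀ j → j ≢ u → laplacian G x j ≤ 0ℚ) → ∀ j → x j ≤ x u
    maximum-principle {u} connected sub j =
      ≤-trans (x≤x[top] j) (maximum-propagates sub x≤x[top] (connected top u) ≤-refl)
      where
      top : Fin n
      top = argmax x u (allFin n)
      x≤x[top] : ∀ j → x j ≤ x top
      x≤x[top] j = All.lookup (f[xs]≤f[argmax] {f = x} u (allFin n)) (∈-allFin j)

    potential-max : Connected G → Potential G u v x → ∀ j → x j ≤ x u
    potential-max connected pot = maximum-principle connected (potential-subharmonic pot)

    sumFin-nonEdgeTerm : ∀ w →
                         sumFin n (nonEdgeTerm G x w) ≡ sumFin n (λ j → x w - x j) - laplacian G x w
    sumFin-nonEdgeTerm w = trans (sumFin-cong λ j → b2q-not-* (adj G w j) (x w - x j))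
      (sumFin-− {f = λ j → x w - x j})

    nonEdgeTerm-nonneg : ∀ {w j} → x j ≤ x w → 0ℚ ≤ nonEdgeTerm G x w j
    nonEdgeTerm-nonneg {w} {j} = b2q-*-nonneg (not (adj G w j)) ∘ p≤q⇒0≤q-p

    nonEdgeTerm-≤0 : ∀ {w j} → adj G w j ≡ false → nonEdgeTerm G x w j ≤ 0ℚ → x w ≤ x j
    nonEdgeTerm-≤0 {w} {j} w≁j term≤0 = p-q≤0⇒p≤q (subst (_≤ 0ℚ) (*-identityˡ (x w - x j))
      (subst (λ a → b2q (not a) * (x w - x j) ≤ 0ℚ) w≁j term≤0))

  potential-sumFin-nonEdgeTerms : ∀ (G : Graph n) x → u ≢ v → Potential G u v x →
    sumFin n (λ j → nonEdgeTerm G x u j + nonEdgeTerm G (-_ ∘ x) v j) ≡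
    sumFin n (λ _ → x u - x v) - (1ℚ + 1ℚ)
  potential-sumFin-nonEdgeTerms {n = n} {u = u} {v} G x u≢v pot = begin
    sumFin n (λ j → nonEdgeTerm G x u j + nonEdgeTerm G x⁻ v j)
      ≡⟨ sumFin-+ {f = nonEdgeTerm G x u} ⟩
    sumFin n (nonEdgeTerm G x u) + sumFin n (nonEdgeTerm G x⁻ v)
      ≡⟨ cong₂ _+_ (sumFin-nonEdgeTerm G x u) (sumFin-nonEdgeTerm G x⁻ v) ⟩
    (Σu - laplacian G x u) + (Σv - laplacian G x⁻ v)
      ≡⟨ cong₂ (λ a b → (Σu - a) + (Σv - b))
           (potential-source G x u≢v pot) (potential-source G x⁻ (u≢v ∘ sym) (potential-neg G x pot)) ⟩
    (Σu - 1ℚ) + (Σv - 1ℚ)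
      ≡⟨ solve 2 (λ a b → (a :- con 1ℚ) :+ (b :- con 1ℚ) := (a :+ b) :- (con 1ℚ :+ con 1ℚ)) refl Σu Σv ⟩
    (Σu + Σv) - (1ℚ + 1ℚ)
      ≡⟨ cong (_- (1ℚ + 1ℚ)) (trans (sym (sumFin-+ {f = λ j → x u - x j})) (sumFin-cong telescope)) ⟩
    sumFin n (λ _ → x u - x v) - (1ℚ + 1ℚ) ∎
    where
    open ≡-Reasoning
    x⁻ : Fin n → ℚ
    x⁻ = -_ ∘ x
    Σu Σv : ℚ
    Σu = sumFin n (λ j → x u - x j)
    Σv = sumFin n (λ j → x⁻ v - x⁻ j)
    telescope : ∀ j → (x u - x j) + (x⁻ v - x⁻ j) ≡ x u - x v
    telescope j = solve 3 (λ p q r → (p :- r) :+ ((:- q) :- (:- r)) := p :- q) refl (x u) (x v) (x j)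

  resistance-sym : ∀ {G : Graph n} → ResistanceIs G u v r → ResistanceIs G v u r
  resistance-sym {u = u} {v} {G = G} (x , pot , refl) =
    -_ ∘ x , potential-neg G x pot , solve 2 (λ p q → (:- q) :- (:- p) := p :- q) refl (x u) (x v)

  Universal : Graph n → Fin n → Set
  Universal G u = ∀ k → k ≢ u → adj G u k ≡ true

  resistance-2/n⇒universal : ∀ {G : Graph n} → Connected G → u ≢ v → ResistanceIs G u v r →
                             0ℚ < r → sumFin n (λ _ → r) ≡ 1ℚ + 1ℚ → Universal G u
  resistance-2/n⇒universal {u = u} {v} {G = G} connected u≢v (x , pot , refl) r>0 nr≡2 k k≢u
    with adj G u k in u≁k
  ... | true  = refl
  ... | false = ⊥-elim (<-irrefl refl (<-≤-trans r>0 (p≤q⇒p-q≤0 xu≤xv)))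
    -- Both non-edge terms at k vanish, so x k = x u is maximal.  Then either k ≁ v and x k ≤ x v, or
    -- k ∼ v and, x being subharmonic at the maximum k, x v is maximal as well.
    where
    x⁻ : Fin _ → ℚ
    x⁻ = -_ ∘ x
    x≤xu : ∀ j → x j ≤ x u
    x≤xu = potential-max G x connected pot
    nonneg-u : ∀ j → 0ℚ ≤ nonEdgeTerm G x u j
    nonneg-u j = nonEdgeTerm-nonneg G x (x≤xu j)
    nonneg-v : ∀ j → 0ℚ ≤ nonEdgeTerm G x⁻ v j
    nonneg-v j = nonEdgeTerm-nonneg G x⁻ (potential-max G x⁻ connected (potential-neg G x pot) j)
    terms-at-k≤0 : nonEdgeTerm G x u k + nonEdgeTerm G x⁻ v k ≤ 0ℚ
    terms-at-k≤0 = subst (nonEdgeTerm G x u k + nonEdgeTerm G x⁻ v k ≤_)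
      (trans (potential-sumFin-nonEdgeTerms G x u≢v pot) (cong (_- (1ℚ + 1ℚ)) nr≡2))
      (term≤sumFin (λ j → +-mono-≤ (nonneg-u j) (nonneg-v j)) k)
    xu≤xk : x u ≤ x k
    xu≤xk = nonEdgeTerm-≤0 G x u≁k (≤-trans (p≤p+q (nonneg-v k)) terms-at-k≤0)
    xu≤xv : x u ≤ x v
    xu≤xv with adj G v k in adj-vk
    ... | false = ≤-trans xu≤xk
                    (neg-cancel-≤ (nonEdgeTerm-≤0 G x⁻ adj-vk (≤-trans (p≤q+p (nonneg-u k)) terms-at-k≤0)))
    ... | true  = neighbour-of-maximum G x x≤xu xu≤xk (potential-subharmonic G x pot k k≢u)
                    (trans (Graph.sym G k v) adj-vk)

  resistance-twoOver⇒universal : ∀ {k} {G : Graph (suc k)} {u v} → Connected G → u ≢ v →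
                                 ResistanceIs G u v (twoOver (suc k)) → Universal G u
  resistance-twoOver⇒universal {k} connected u≢v Ω =
    resistance-2/n⇒universal connected u≢v Ω (twoOver-pos k) (sumFin-twoOver k)

open ResistanceDistance using (Universal; resistance-sym; resistance-twoOver⇒universal)

open import Data.Nat using (suc; _≤_; _*_; _+_; _∸_; _<_; s≤s)
open import Data.Nat.Properties using (<-asym; <-irrefl; m≤m+n; m+n∸n≡m; +-identityʳ; module ≤-Reasoning)
import Data.Nat.Tactic.RingSolver as ℕ-Solver
open import Data.Fin using (toℕ; zero; suc; punchOut; combine)
open import Data.Fin.Properties using (_≟_; punchOut-injective; combine-injective; injective⇒≤; ¬∀⟶∃¬; all?)
open import Data.Product using (_×_; _,_; proj₁; proj₂; swap; ∃-syntax)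
open import Data.List using (List; length; lookup; map; _++_)
open import Data.List.Properties using (length-++; length-map)
open import Data.List.Relation.Unary.All as All using (All)
import Data.List.Relation.Unary.All.Properties as All
open import Data.List.Relation.Unary.Unique.Propositional using (Unique)
open import Data.List.Relation.Unary.AllPairs using (_∷_)
import Data.List.Relation.Unary.Unique.Propositional.Properties as Unique
open import Data.List.Relation.Binary.Disjoint.Propositional using (Disjoint)
open import Data.List.Membership.Propositional.Properties using (∈-lookup; ∈-map⁻)
open import Data.Bool using (true; false)
open import Data.Bool.Properties using (¬-not) renaming (_≟_ to _≟ᵇ_)
open import Relation.Binary.Definitions using (Asymmetric)
open import Relation.Binary.PropositionalEquality
open import Relation.Nullary using (¬_; Dec; contradiction)
open import Relation.Nullary.Decidable using (¬?; _→-dec_)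
open import Function using (_∘_; const)

private variable
  A : Set
  n k : ℕ
  xs : List A

lookup-injective : Unique xs → ∀ {i j} → lookup xs i ≡ lookup xs j → i ≡ j
lookup-injective (_ ∷ _)      {zero}  {zero}  _     = refl
lookup-injective (x∉xs ∷ _)   {zero}  {suc j} x≡xⱼ  = contradiction x≡xⱼ (All.lookup x∉xs (∈-lookup j))
lookup-injective (x∉xs ∷ _)   {suc i} {zero}  xᵢ≡x  = contradiction (sym xᵢ≡x) (All.lookup x∉xs (∈-lookup i))
lookup-injective (_ ∷ unique) {suc i} {suc j} xᵢ≡xⱼ = cong suc (lookup-injective unique xᵢ≡xⱼ)

Unique⇒length≤ : {P : A → Set} (code : ∀ a → P a → Fin n) →
                 (∀ {a b} pa pb → code a pa ≡ code b pb → a ≡ b) →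
                 Unique xs → All P xs → length xs ≤ n
Unique⇒length≤ {xs = xs} code code-injective unique pxs =
  injective⇒≤ {f = λ i → code (lookup xs i) (All.lookup pxs (∈-lookup i))}
    (lookup-injective unique ∘ code-injective _ _)

Off : Fin n → Fin n → Fin n → Set
Off a b c = a ≢ c × b ≢ c

punchOut₂ : {a b c : Fin (suc (suc n))} → a ≢ b → Off a b c → Fin n
punchOut₂ a≢b (a≢c , b≢c) = punchOut (b≢c ∘ punchOut-injective a≢b a≢c)

punchOut₂-injective : ∀ {a b c c′ : Fin (suc (suc n))} (a≢b : a ≢ b) (off : Off a b c) (off′ : Off a b c′) →
                      punchOut₂ a≢b off ≡ punchOut₂ a≢b off′ → c ≡ c′
punchOut₂-injective a≢b (a≢c , b≢c) (a≢c′ , b≢c′) eq = punchOut-injective a≢c a≢c′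
  (punchOut-injective (b≢c ∘ punchOut-injective a≢b a≢c) (b≢c′ ∘ punchOut-injective a≢b a≢c′) eq)

distinctPairIndex : {p q : Fin (suc k)} → p ≢ q → Fin (suc k * k)
distinctPairIndex {p = p} p≢q = combine p (punchOut p≢q)

distinctPairIndex-injective : ∀ {p q p′ q′ : Fin (suc k)} (p≢q : p ≢ q) (p′≢q′ : p′ ≢ q′) →
                              distinctPairIndex p≢q ≡ distinctPairIndex p′≢q′ → p ≡ p′ × q ≡ q′
distinctPairIndex-injective {p = p} {p′ = p′} p≢q p′≢q′ eq with combine-injective p _ p′ _ eq
... | refl , eq′ = refl , punchOut-injective p≢q p′≢q′ eq′

OffPair : Fin n → Fin n → Fin n × Fin n → Set
OffPair a b (p , q) = p ≢ q × Off a b p × Off a b q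

OffPair-swap : ∀ {a b : Fin n} {pq} → OffPair a b pq → OffPair a b (swap pq)
OffPair-swap (p≢q , p-off , q-off) = p≢q ∘ sym , q-off , p-off

offPairs-length≤ : ∀ {a b : Fin (suc (suc (suc k)))} {ps} → a ≢ b →
                   Unique ps → All (OffPair a b) ps → length ps ≤ suc k * k
offPairs-length≤ {a = a} {b} a≢b = Unique⇒length≤ (λ _ → index) index-injective
  where
  index : ∀ {pq} → OffPair a b pq → Fin _
  index (p≢q , p-off , q-off) = distinctPairIndex (p≢q ∘ punchOut₂-injective a≢b p-off q-off)
  index-injective : ∀ {pq pq′} (off : OffPair a b pq) (off′ : OffPair a b pq′) →
                    index off ≡ index off′ → pq ≡ pq′
  index-injective (_ , p-off , q-off) (_ , p′-off , q′-off) eq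
    with p≡p′ , q≡q′ ← distinctPairIndex-injective _ _ eq =
    cong₂ _,_ (punchOut₂-injective a≢b p-off p′-off p≡p′) (punchOut₂-injective a≢b q-off q′-off q≡q′)

Unique-++-map-swap : ∀ {R : A → A → Set} {ps : List (A × A)} → Asymmetric R →
                     All (λ pq → R (proj₁ pq) (proj₂ pq)) ps → Unique ps → Unique (ps ++ map swap ps)
Unique-++-map-swap {ps = ps} asym ordered unique =
  Unique.++⁺ unique (Unique.map⁺ (cong swap) unique) disjoint
  where
  disjoint : Disjoint ps (map swap ps)
  disjoint (pq∈ps , pq∈swapped) with qp , qp∈ps , refl ← ∈-map⁻ swap pq∈swapped =
    asym (All.lookup ordered qp∈ps) (All.lookup ordered pq∈ps)

length-++-map-swap : ∀ (ps : List (A × A)) → length (ps ++ map swap ps) ≡ 2 * length ps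
length-++-map-swap ps = begin
  length (ps ++ map swap ps)        ≡⟨ length-++ ps ⟩
  length ps + length (map swap ps)  ≡⟨ cong (length ps +_) (length-map swap ps) ⟩
  length ps + length ps             ≡⟨ cong (length ps +_) (+-identityʳ (length ps)) ⟨
  2 * length ps                     ∎
  where open ≡-Reasoning

adjacent-if-distinct? : (G : Graph n) → ∀ a b → Dec (a ≢ b → adj G a b ≡ true)
adjacent-if-distinct? G a b = ¬? (a ≟ b) →-dec (adj G a b ≟ᵇ true)

nonAdjacentPair : (G : Graph n) → ¬ Complete G → ∃[ a ] ∃[ b ] (a ≢ b × adj G a b ≡ false)
nonAdjacentPair G incomplete
  with a , ¬universal-a ← ¬∀⟶∃¬ _ _ (λ a → all? (adjacent-if-distinct? G a)) incomplete
  with b , ¬a∼b ← ¬∀⟶∃¬ _ _ (adjacent-if-distinct? G a) ¬universal-a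
  = a , b , (λ a≡b → ¬a∼b λ a≢b → contradiction a≡b a≢b) , ¬-not (¬a∼b ∘ const)

universal⇒Off : ∀ {G : Graph n} {a b c} → a ≢ b → adj G a b ≡ false → Universal G c → Off a b c
universal⇒Off {G = G} {a} {b} a≢b a≁b universal =
    (λ { refl → a≁b′ (universal b (a≢b ∘ sym)) })
  , (λ { refl → a≁b′ (trans (Graph.sym G a b) (universal a a≢b)) })
  where
  a≁b′ : adj G a b ≢ true
  a≁b′ a∼b = contradiction (trans (sym a∼b) a≁b) λ ()

distinctPairCount≤bound : ∀ k → let N = suc (suc (suc k)) in suc k * k ≤ (N * N + 8) ∸ 5 * N
distinctPairCount≤bound k = begin
  suc k * k                        ≤⟨ m≤m+n (suc k * k) 2 ⟩
  suc k * k + 2                    ≡⟨ m+n∸n≡m (suc k * k + 2) (5 * N) ⟨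
  (suc k * k + 2) + 5 * N ∸ 5 * N  ≡⟨ cong (_∸ 5 * N) (expand k) ⟩
  (N * N + 8) ∸ 5 * N              ∎
  where
  open ≤-Reasoning
  N = suc (suc (suc k))
  expand : ∀ k → (suc k * k + 2) + 5 * suc (suc (suc k)) ≡ suc (suc (suc k)) * suc (suc (suc k)) + 8
  expand = ℕ-Solver.solve-∀

mainTheorem13 : (n : ℕ) → 3 ≤ n → (G : Graph n) → Connected G → ¬ Complete G →
    (ps : List (Fin n × Fin n)) → Unique ps →
    All (λ p → (toℕ (proj₁ p) < toℕ (proj₂ p)) × ResistanceIs G (proj₁ p) (proj₂ p) (twoOver n)) ps →
    2 * length ps ≤ (n * n + 8) ∸ 5 * n
mainTheorem13 (suc (suc (suc k))) (s≤s (s≤s (s≤s _))) G connected incomplete ps unique hyps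
  with a , b , a≢b , a≁b ← nonAdjacentPair G incomplete = begin
  2 * length ps               ≡⟨ length-++-map-swap ps ⟨
  length (ps ++ map swap ps)  ≤⟨ offPairs-length≤ a≢b (Unique-++-map-swap <-asym (All.map proj₁ hyps) unique)
                                   (All.++⁺ offPairs (All.map⁺ (All.map OffPair-swap offPairs))) ⟩
  suc k * k                   ≤⟨ distinctPairCount≤bound k ⟩
  _                           ∎
  where
  open ≤-Reasoning
  universal⇒Off′ : ∀ {c} → Universal G c → Off a b c
  universal⇒Off′ = universal⇒Off {G = G} a≢b a≁b
  offPair : ∀ {p q} → toℕ p < toℕ q → ResistanceIs G p q (twoOver (suc (suc (suc k)))) → OffPair a b (p , q)
  offPair {p} {q} p<q Ω = p≢q
    , universal⇒Off′ (resistance-twoOver⇒universal connected p≢q Ω)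
    , universal⇒Off′ (resistance-twoOver⇒universal connected (p≢q ∘ sym) (resistance-sym {G = G} Ω))
    where
    p≢q : p ≢ q
    p≢q p≡q = <-irrefl (cong toℕ p≡q) p<q
  offPairs : All (OffPair a b) ps
  offPairs = All.map (λ (p<q , Ω) → offPair p<q Ω) hyps
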